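{- Let $q,r$ be positive integers and $\alpha$ a real number. Suppose that for all positive integers $N$ we have $f_{q,r}(N)\geq N^{\alpha-\varepsilon(N)}$, for some function $\varepsilon$ with $\lim_{N\to\infty}\varepsilon(N)=0$. Then $f_{q,r}(N)\geq N^{\alpha}$ for all positive integers $N$.
   Context: For a $q$-edge-colored complete graph $K$ with a linear order on its vertices, $f_{q,r}(K)$ is the maximum number of vertices of a monotone path (vertices increasing in traversal order) in $K$ whose edges use at most $r$ colors; $f_{q,r}(N)$ is the minimum of $f_{q,r}(K)$ over all such $K$ on $N$ vertices.
   Formalization: The function ε in the hypothesis takes only rational values. -}

module Defs where

open import Data.Nat using (ℕ; zero; suc; _+_; _*_; _^_; _≤_)
open import Data.Integer using (ℤ; +_; -[1+_])
open import Data.Rational using (ℚ; ↥_; ↧ₙ_; _<_; _-_; ∣_∣; 0ℚ)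
open import Data.Fin using (Fin)
import Data.Fin as F
open import Data.List using (List; []; _∷_; length)
open import Data.List.Relation.Unary.All using (All)
open import Data.List.Relation.Unary.Linked using (Linked)
open import Data.List.Membership.Propositional using (_∈_)
open import Data.Product using (Σ; ∃; _×_; _,_)
open import Relation.Nullary using (¬_)

-- A q-edge-colouring of the complete graph on the ordered vertex set Fin N
-- (vertex order = order of Fin).  Only the values c i j with i < j are ever
-- used, so every edge-colouring arises from such a function.
Colouring : ℕ → ℕ → Set
Colouring q N = Fin N → Fin N → Fin q

edgeColours : ∀ {q N} → Colouring q N → List (Fin N) → List (Fin q)
edgeColours c [] = []
edgeColours c (x ∷ []) = []
edgeColours c (x ∷ y ∷ xs) = c x y ∷ edgeColours c (y ∷ xs)

Monotone : ∀ {N} → List (Fin N) → Set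
Monotone = Linked F._<_

UsesAtMost : ∀ {q} → ℕ → List (Fin q) → Set
UsesAtMost {q} r cs = Σ (List (Fin q)) λ S → (length S ≤ r) × All (_∈ S) cs

GoodPath : ∀ {q N} → ℕ → Colouring q N → List (Fin N) → Set
GoodPath r c p = Monotone p × UsesAtMost r (edgeColours c p)

-- "f_{q,r}(N) ≥ y", where the bound y is given as the predicate P on the
-- number of vertices k meaning "k ≥ y".  Since f_{q,r}(N) is the minimum over
-- colourings of the maximum length of a good path, f_{q,r}(N) ≥ y iff every
-- colouring has a good path with a vertex count k satisfying k ≥ y.
fAtLeast : (q r N : ℕ) → (ℕ → Set) → Set
fAtLeast q r N P =
  (c : Colouring q N) → Σ (List (Fin N)) λ p → GoodPath r c p × P (length p)

-- N ^ s ≤ k for a rational exponent s = a / b (b > 0), N ≥ 1: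
-- equivalent to N^a ≤ k^b, and for a = -(n+1) to 1 ≤ k^b * N^(n+1).
infix 4 _^[_]≤_
_^[_]≤_ : ℕ → ℚ → ℕ → Set
N ^[ s ]≤ k with ↥ s
... | + a = N ^ a ≤ k ^ (↧ₙ s)
... | -[1+ a ] = 1 ≤ k ^ (↧ₙ s) * N ^ (suc a)

-- A real number α, represented by its Dedekind lower cut {s ∈ ℚ | s < α}.
record ℝ : Set₁ where
  field
    Lower     : ℚ → Set
    inhabited : ∃ Lower
    bounded   : ∃ λ u → ¬ Lower u
    downward  : ∀ {s t} → s < t → Lower t → Lower s
    rounded   : ∀ {s} → Lower s → ∃ λ t → Lower t × s < t
open ℝ public

TendsToZero : (ℕ → ℚ) → Set
TendsToZero ε = ∀ δ → 0ℚ < δ → ∃ λ M → ∀ N → M ≤ N → ∣ ε N ∣ < δ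

-- "f_{q,r}(N) ≥ N^(α - e)" for real α and rational e: since N ≥ 1 and x ↦ N^x
-- is continuous, N^(α-e) ≤ k iff N^(s-e) ≤ k for all rationals s < α.
fAtLeastPow : (q r N : ℕ) → ℝ → ℚ → Set
fAtLeastPow q r N α e =
  fAtLeast q r N (λ k → ∀ s → Lower α s → N ^[ s - e ]≤ k)

-- Call a monotone path good if its edges use at most r colours.  In the lexicographic product
-- of two colourings (edges inside a block coloured by the second, edges between blocks by the
-- first) a good path splits into blocks that form a good path of the first colouring, each
-- block being a good path of the second with the same colour set; so the longest good path of
-- the product is at most as long as the product of those of the factors.  Hence if every good
-- path of a colouring c of N vertices has at most L vertices, the k-th lexicographic power of
-- c colours N^k vertices with no good path longer than L^k.  For rationals s < t < α the
-- hypothesis then gives (N^k)^(t - ε(N^k)) ≤ L^k, and for large k we have s < t - ε(N^k), so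
-- N^s ≤ L.
module Submission where

open import Defs
open import Data.Nat using (ℕ; zero; suc; _+_; _*_; _^_; _≤_; _<_; z≤n; s≤s; NonZero; >-nonZero)
import Data.Nat.Properties as ℕ
open import Data.Integer as ℤ using (+_; -[1+_])
import Data.Integer.Properties as ℤ
open import Data.Rational as ℚ using (ℚ; 0ℚ; ↥_; ↧ₙ_; ∣_∣; -_; _-_; mkℚ)
import Data.Rational.Properties as ℚ
open import Data.Rational.Solver using (module +-*-Solver)
open import Data.Fin as Fin using (Fin; toℕ; combine; quotient; remainder)
import Data.Fin.Properties as Fin
open import Data.List using (List; []; _∷_; [_]; length; cartesianProductWith; allFin; filter)
open import Data.List.Extrema.Nat using (argmax; argmax-all; f[xs]≤f[argmax])
open import Data.List.Relation.Unary.All as All using (All; []; _∷_)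
open import Data.List.Relation.Unary.All.Properties using (all-filter)
open import Data.List.Relation.Unary.Any using (Any; here; there; any?; satisfied)
open import Data.List.Relation.Unary.Linked using ([]; [-]; _∷_; linked?)
open import Data.List.Membership.Propositional using (_∈_; lose)
open import Data.List.Membership.Propositional.Properties
  using (∈-allFin; ∈-cartesianProductWith⁺; ∈-filter⁺)
import Data.List.Membership.DecPropositional as DecMembership
open import Data.Product using (Σ; _×_; _,_; proj₁)
open import Data.Sum using (_⊎_; inj₁; inj₂)
open import Relation.Binary.Definitions using (tri<; tri≈; tri>)
open import Relation.Binary.PropositionalEquality
  using (_≡_; _≢_; refl; sym; cong; subst; subst₂; module ≡-Reasoning)
open import Relation.Nullary using (Dec; yes; no; contradiction)
open import Relation.Nullary.Decidable using (map′; _×-dec_)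
open import Relation.Unary using (Decidable)

monotone-length+toℕ≤ : ∀ {N} {x : Fin N} {p} → Monotone (x ∷ p) → length (x ∷ p) + toℕ x ≤ N
monotone-length+toℕ≤ {x = x} [-] = Fin.toℕ<n x
monotone-length+toℕ≤ {x = x} {y ∷ p} (x<y ∷ mono) = begin
  suc (length (y ∷ p) + toℕ x) ≡⟨ ℕ.+-suc (length (y ∷ p)) (toℕ x) ⟨
  length (y ∷ p) + suc (toℕ x) ≤⟨ ℕ.+-monoʳ-≤ (length (y ∷ p)) x<y ⟩
  length (y ∷ p) + toℕ y       ≤⟨ monotone-length+toℕ≤ mono ⟩
  _                            ∎
  where open ℕ.≤-Reasoning

monotone-length≤ : ∀ {N} {p : List (Fin N)} → Monotone p → length p ≤ N
monotone-length≤ [] = z≤n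
monotone-length≤ {p = _ ∷ _} mono = ℕ.≤-trans (ℕ.m≤m+n _ _) (monotone-length+toℕ≤ mono)

lists≤ : ∀ {A : Set} → List A → ℕ → List (List A)
lists≤ xs zero    = [ [] ]
lists≤ xs (suc n) = [] ∷ cartesianProductWith _∷_ xs (lists≤ xs n)

∈-lists≤ : ∀ {A : Set} {xs : List A} → (∀ x → x ∈ xs) →
           ∀ {n} ys → length ys ≤ n → ys ∈ lists≤ xs n
∈-lists≤ complete {zero}  []       _         = here refl
∈-lists≤ complete {suc n} []       _         = here refl
∈-lists≤ complete {suc n} (y ∷ ys) (s≤s len) =
  there (∈-cartesianProductWith⁺ _∷_ (complete y) (∈-lists≤ complete ys len))

usesAtMost? : ∀ {q} r (cs : List (Fin q)) → Dec (UsesAtMost r cs)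
usesAtMost? {q} r cs = map′ satisfied found (any? covers? (lists≤ (allFin q) r))
  where
  Covers : List (Fin q) → Set
  Covers S = length S ≤ r × All (_∈ S) cs
  covers? : Decidable Covers
  covers? S = (length S ℕ.≤? r) ×-dec All.all? (λ x → DecMembership._∈?_ Fin._≟_ x S) cs
  found : UsesAtMost r cs → Any Covers (lists≤ (allFin q) r)
  found (S , covers) = lose (∈-lists≤ ∈-allFin S (proj₁ covers)) covers

goodPath? : ∀ {q N} r (c : Colouring q N) → Decidable (GoodPath r c)
goodPath? r c p = linked? Fin._<?_ p ×-dec usesAtMost? r (edgeColours c p)

singleton-goodPath : ∀ {q N} r (c : Colouring q N) v → GoodPath r c [ v ]
singleton-goodPath r c v = [-] , [] , z≤n , []

module _ {A : Set} {P : A → Set} (P? : Decidable P) (m : A → ℕ) where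

  maximise : ∀ xs {x₀} → P x₀ → Σ A λ x → P x × (∀ {y} → y ∈ xs → P y → m y ≤ m x)
  maximise xs {x₀} Px₀ = argmax m x₀ candidates , argmax-all m Px₀ (all-filter P? xs) , bound
    where
    candidates : List A
    candidates = filter P? xs
    bound : ∀ {y} → y ∈ xs → P y → m y ≤ m (argmax m x₀ candidates)
    bound y∈xs Py = All.lookup (f[xs]≤f[argmax] x₀ candidates) (∈-filter⁺ P? y∈xs Py)

longestGoodPath : ∀ {q N} r (c : Colouring q N) → Fin N →
  Σ (List (Fin N)) λ p → GoodPath r c p × (∀ {p′} → GoodPath r c p′ → length p′ ≤ length p)
longestGoodPath {N = N} r c v
  with p , good , longest ←
         maximise (goodPath? r c) length (lists≤ (allFin N) N) (singleton-goodPath r c v)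
  = p , good , λ good′@(mono , _) → longest (∈-lists≤ ∈-allFin _ (monotone-length≤ mono)) good′

PathWithin : ∀ {q N} → List (Fin q) → Colouring q N → List (Fin N) → Set
PathWithin S c p = Monotone p × All (_∈ S) (edgeColours c p)

PathsWithin≤ : ∀ {q N} → List (Fin q) → Colouring q N → ℕ → Set
PathsWithin≤ S c L = ∀ {p} → PathWithin S c p → length p ≤ L

PathWithin-∷ : ∀ {q N S} {c : Colouring q N} {x y p} → x Fin.< y → c x y ∈ S →
               PathWithin S c (y ∷ p) → PathWithin S c (x ∷ y ∷ p)
PathWithin-∷ x<y xy∈S (mono , cols) = x<y ∷ mono , xy∈S ∷ cols

combine-<-lex : ∀ {A B} {i i′ : Fin A} {j j′ : Fin B} → combine i j Fin.< combine i′ j′ →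
                i Fin.< i′ ⊎ (i ≡ i′ × j Fin.< j′)
combine-<-lex {B = B} {i} {i′} {j} {j′} ij<i′j′ with Fin.<-cmp i i′
... | tri< i<i′ _ _ = inj₁ i<i′
... | tri≈ _ refl _ = inj₂ (refl , ℕ.+-cancelˡ-< (B * toℕ i) (toℕ j) (toℕ j′)
        (subst₂ _<_ (Fin.toℕ-combine i j) (Fin.toℕ-combine i′ j′) ij<i′j′))
... | tri> _ _ i′<i = contradiction ij<i′j′ (ℕ.<⇒≯ (Fin.combine-monoˡ-< j′ j i′<i))

module Blocks (A B : ℕ) where

  block : Fin (A * B) → Fin A
  block = quotient B

  offset : Fin (A * B) → Fin B
  offset = remainder {A} B

  <-lex : ∀ {v w} → v Fin.< w → block v Fin.< block w ⊎ (block v ≡ block w × offset v Fin.< offset w)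
  <-lex {v} {w} v<w = combine-<-lex
    (subst₂ Fin._<_ (sym (Fin.combine-remQuot {A} B v)) (sym (Fin.combine-remQuot {A} B w)) v<w)

module _ {q A B : ℕ} (c₁ : Colouring q A) (c₂ : Colouring q B) where
  open Blocks A B

  lexProduct : Colouring q (A * B)
  lexProduct v w with block v Fin.≟ block w
  ... | yes _ = c₂ (offset v) (offset w)
  ... | no  _ = c₁ (block v) (block w)

  lexProduct-inner : ∀ {v w} → block v ≡ block w → lexProduct v w ≡ c₂ (offset v) (offset w)
  lexProduct-inner {v} {w} same with block v Fin.≟ block w
  ... | yes _    = refl
  ... | no  diff = contradiction same diff

  lexProduct-outer : ∀ {v w} → block v ≢ block w → lexProduct v w ≡ c₁ (block v) (block w)
  lexProduct-outer {v} {w} diff with block v Fin.≟ block w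
  ... | yes same = contradiction same diff
  ... | no  _    = refl

  module _ {S : List (Fin q)} {L₂ : ℕ} (bound₂ : PathsWithin≤ S c₂ L₂) where

    -- The blocks a path x ∷ p visits after that of x, and the offsets of its later vertices
    -- lying in the block of x.
    record BlockDecomposition (x : Fin (A * B)) (p : List (Fin (A * B))) : Set where
      field
        laterBlocks  : List (Fin A)
        laterOffsets : List (Fin B)
        outerPath    : PathWithin S c₁ (block x ∷ laterBlocks)
        innerPath    : PathWithin S c₂ (offset x ∷ laterOffsets)
        length≤      : length (x ∷ p) ≤ length (offset x ∷ laterOffsets) + length laterBlocks * L₂

    decompose : ∀ {x p} → PathWithin S lexProduct (x ∷ p) → BlockDecomposition x p
    decompose ([-] , []) = record
      { laterBlocks  = []
      ; laterOffsets = []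
      ; outerPath    = [-] , []
      ; innerPath    = [-] , []
      ; length≤      = s≤s z≤n
      }
    decompose {x} {y ∷ p} (x<y ∷ mono , xy∈S ∷ cols) with <-lex x<y
    ... | inj₂ (same , offset<) = record
      { laterBlocks  = laterBlocks
      ; laterOffsets = offset y ∷ laterOffsets
      ; outerPath    = subst (λ b → PathWithin S c₁ (b ∷ laterBlocks)) (sym same) outerPath
      ; innerPath    = PathWithin-∷ offset< (subst (_∈ S) (lexProduct-inner same) xy∈S) innerPath
      ; length≤      = s≤s length≤
      }
      where open BlockDecomposition (decompose (mono , cols))
    ... | inj₁ block< = record
      { laterBlocks  = block y ∷ laterBlocks
      ; laterOffsets = []
      ; outerPath    =
          PathWithin-∷ block< (subst (_∈ S) (lexProduct-outer (Fin.<⇒≢ block<)) xy∈S) outerPath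
      ; innerPath    = [-] , []
      ; length≤      =
          s≤s (ℕ.≤-trans length≤ (ℕ.+-monoˡ-≤ (length laterBlocks * L₂) (bound₂ innerPath)))
      }
      where open BlockDecomposition (decompose (mono , cols))

  lexProduct-bound : ∀ {S L₁ L₂} → PathsWithin≤ S c₁ L₁ → PathsWithin≤ S c₂ L₂ →
                     PathsWithin≤ S lexProduct (L₁ * L₂)
  lexProduct-bound                bound₁ bound₂ {[]}    _    = z≤n
  lexProduct-bound {L₁ = L₁} {L₂} bound₁ bound₂ {x ∷ p} path = begin
    length (x ∷ p)
      ≤⟨ length≤ ⟩
    length (offset x ∷ laterOffsets) + length laterBlocks * L₂
      ≤⟨ ℕ.+-monoˡ-≤ _ (bound₂ innerPath) ⟩
    length (block x ∷ laterBlocks) * L₂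
      ≤⟨ ℕ.*-monoˡ-≤ L₂ (bound₁ outerPath) ⟩
    L₁ * L₂
      ∎
    where
    open BlockDecomposition (decompose bound₂ path)
    open ℕ.≤-Reasoning

lexPower : ∀ {q N} → Fin q → Colouring q N → (k : ℕ) → Colouring q (N ^ k)
lexPower colour c zero    = λ _ _ → colour
lexPower colour c (suc k) = lexProduct c (lexPower colour c k)

lexPower-bound : ∀ {q N S L} colour (c : Colouring q N) → PathsWithin≤ S c L →
                 ∀ k → PathsWithin≤ S (lexPower colour c k) (L ^ k)
lexPower-bound colour c bound zero    (mono , _) = monotone-length≤ mono
lexPower-bound colour c bound (suc k) =
  lexProduct-bound c (lexPower colour c k) bound (lexPower-bound colour c bound k)

^-cancelʳ-≤ : ∀ {m n} o .{{_ : NonZero o}} → m ^ o ≤ n ^ o → m ≤ n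
^-cancelʳ-≤ o mᵒ≤nᵒ = ℕ.≮⇒≥ λ n<m → ℕ.<⇒≱ (ℕ.^-monoˡ-< o n<m) mᵒ≤nᵒ

^-comm : ∀ m n o → (m ^ n) ^ o ≡ (m ^ o) ^ n
^-comm m n o = begin
  (m ^ n) ^ o ≡⟨ ℕ.^-*-assoc m n o ⟩
  m ^ (n * o) ≡⟨ cong (m ^_) (ℕ.*-comm n o) ⟩
  m ^ (o * n) ≡⟨ ℕ.^-*-assoc m o n ⟨
  (m ^ o) ^ n ∎
  where open ≡-Reasoning

n<m^n : ∀ {m} → 1 < m → ∀ n → n < m ^ n
n<m^n 1<m zero    = s≤s z≤n
n<m^n 1<m (suc n) = ℕ.≤-<-trans (n<m^n 1<m n) (ℕ.^-monoʳ-< _ 1<m (ℕ.n<1+n n))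

1≤^ : ∀ {m} → 1 ≤ m → ∀ n → 1 ≤ m ^ n
1≤^ 1≤m n = ℕ.m^n>0 _ {{>-nonZero 1≤m}} n

1≤^*^ : ∀ {m n} → 1 ≤ m → 1 ≤ n → ∀ i j → 1 ≤ m ^ i * n ^ j
1≤^*^ 1≤m 1≤n i j = ℕ.*-mono-≤ (1≤^ 1≤m i) (1≤^ 1≤n j)

^[]≤-monoʳ : ∀ {N k l} s → k ≤ l → N ^[ s ]≤ k → N ^[ s ]≤ l
^[]≤-monoʳ s k≤l Nˢ≤k with ↥ s
... | + a      = ℕ.≤-trans Nˢ≤k (ℕ.^-monoˡ-≤ (↧ₙ s) k≤l)
... | -[1+ a ] = ℕ.≤-trans Nˢ≤k (ℕ.*-monoˡ-≤ _ (ℕ.^-monoˡ-≤ (↧ₙ s) k≤l))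

^[]≤-cancel-^ : ∀ {N L} m .{{_ : NonZero m}} s → 1 ≤ N → 1 ≤ L →
                (N ^ m) ^[ s ]≤ L ^ m → N ^[ s ]≤ L
^[]≤-cancel-^ {N} {L} m s 1≤N 1≤L Nᵐˢ≤Lᵐ with ↥ s
... | + a      = ^-cancelʳ-≤ m (subst₂ _≤_ (^-comm N m a) (^-comm L m (↧ₙ s)) Nᵐˢ≤Lᵐ)
... | -[1+ a ] = 1≤^*^ 1≤L 1≤N (↧ₙ s) (suc a)

1^[]≤ : ∀ {k} s → 1 ≤ k → 1 ^[ s ]≤ k
1^[]≤ s 1≤k with ↥ s
... | + a      = subst (_≤ _) (sym (ℕ.^-zeroˡ a)) (1≤^ 1≤k (↧ₙ s))
... | -[1+ a ] = 1≤^*^ 1≤k (s≤s z≤n) (↧ₙ s) (suc a)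

^[]≤-antitone : ∀ {N k s u} → 1 ≤ N → 1 ≤ k → s ℚ.≤ u → N ^[ u ]≤ k → N ^[ s ]≤ k
^[]≤-antitone {N} {k} {s} {u} 1≤N 1≤k s≤u Nᵘ≤k with ↥ s | ↥ u | ℚ.drop-*≤* s≤u
... | -[1+ a ] | _        | _      = 1≤^*^ 1≤k 1≤N (↧ₙ s) (suc a)
-- impossible, as 0 ≤ s ≤ u < 0
... | + a      | -[1+ c ] | ad≤-cb =
  contradiction (subst (ℤ._≤ _) (sym (ℤ.pos-* a (↧ₙ u))) ad≤-cb) λ ()
... | + a      | + c      | ad≤cb  = ^-cancelʳ-≤ d (begin
  (N ^ a) ^ d ≡⟨ ℕ.^-*-assoc N a d ⟩
  N ^ (a * d) ≤⟨ ℕ.^-monoʳ-≤ N {{>-nonZero 1≤N}} a*d≤c*b ⟩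
  N ^ (c * b) ≡⟨ ℕ.^-*-assoc N c b ⟨
  (N ^ c) ^ b ≤⟨ ℕ.^-monoˡ-≤ b Nᵘ≤k ⟩
  (k ^ d) ^ b ≡⟨ ^-comm k d b ⟩
  (k ^ b) ^ d ∎)
  where
  open ℕ.≤-Reasoning
  b d : ℕ
  b = ↧ₙ s
  d = ↧ₙ u
  a*d≤c*b : a * d ≤ c * b
  a*d≤c*b = ℤ.drop‿+≤+ (subst₂ ℤ._≤_ (sym (ℤ.pos-* a d)) (sym (ℤ.pos-* c b)) ad≤cb)

t-[t-s]≡s : ∀ t s → t - (t - s) ≡ s
t-[t-s]≡s = solve 2 (λ t s → t :- (t :- s) := s) refl
  where open +-*-Solver

p<q⇒0<q-p : ∀ {p q} → p ℚ.< q → 0ℚ ℚ.< q - p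
p<q⇒0<q-p {p} {q} p<q = subst (ℚ._< q - p) (ℚ.+-inverseʳ p) (ℚ.+-monoˡ-< (- p) p<q)

p≤∣p∣ : ∀ p → p ℚ.≤ ∣ p ∣
p≤∣p∣ (mkℚ (+ _)    _ _) = ℚ.≤-refl
p≤∣p∣ p@(mkℚ -[1+ _ ] _ _) = ℚ.<⇒≤ (ℚ.<-≤-trans (ℚ.negative⁻¹ p) (ℚ.0≤∣p∣ p))

∣e∣<t-s⇒s<t-e : ∀ {s} t e → ∣ e ∣ ℚ.< t - s → s ℚ.< t - e
∣e∣<t-s⇒s<t-e {s} t e ∣e∣<t-s =
  subst (ℚ._< t - e) (t-[t-s]≡s t s)
    (ℚ.+-monoʳ-< t (ℚ.neg-antimono-< (ℚ.≤-<-trans (p≤∣p∣ e) ∣e∣<t-s)))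

goodPaths≤⇒^[]≤ : ∀ {q r N L} (α : ℝ) (ε : ℕ → ℚ) → TendsToZero ε →
  (∀ M → 1 ≤ M → fAtLeastPow q r M α (ε M)) → Fin q →
  (c : Colouring q N) → 1 ≤ N → (∀ {p} → GoodPath r c p → length p ≤ L) →
  ∀ {s} → Lower α s → N ^[ s ]≤ L
goodPaths≤⇒^[]≤ {N = 1} _ _ _ _ _ c _ bound {s} _ = 1^[]≤ s (bound (singleton-goodPath _ c Fin.zero))
goodPaths≤⇒^[]≤ {q} {r} {N@(suc (suc _))} {L} α ε ε→0 hyp colour c 1≤N bound {s} s<α
  with t , t<α , s<t ← rounded α s<α
  with k₀ , ε-small ← ε→0 (t - s) (p<q⇒0<q-p s<t)
  with p , (mono , S , lenS , cols) , p-long ←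
         hyp (N ^ suc k₀) (1≤^ 1≤N (suc k₀)) (lexPower colour c (suc k₀))
  = ^[]≤-cancel-^ k s 1≤N 1≤L
      (^[]≤-antitone (1≤^ 1≤N k) (1≤^ 1≤L k) s≤t-εM
        (^[]≤-monoʳ (t - ε M) p≤Lᵏ (p-long t t<α)))
  where
  k M : ℕ
  k = suc k₀
  M = N ^ k
  1≤L : 1 ≤ L
  1≤L = bound (singleton-goodPath r c Fin.zero)
  k₀≤M : k₀ ≤ M
  k₀≤M = ℕ.<⇒≤ (ℕ.<-trans (ℕ.n<1+n k₀) (n<m^n (s≤s (s≤s z≤n)) k))
  s≤t-εM : s ℚ.≤ t - ε M
  s≤t-εM = ℚ.<⇒≤ (∣e∣<t-s⇒s<t-e t (ε M) (ε-small M k₀≤M))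
  p≤Lᵏ : length p ≤ L ^ k
  p≤Lᵏ = lexPower-bound colour c (λ (mono′ , cols′) → bound (mono′ , S , lenS , cols′)) k
           (mono , cols)

proposition3p6 : (q r : ℕ) → 1 ≤ q → 1 ≤ r → (α : ℝ)
    → Σ (ℕ → ℚ) (λ ε → TendsToZero ε × (∀ N → 1 ≤ N → fAtLeastPow q r N α (ε N)))
    → ∀ N → 1 ≤ N → fAtLeastPow q r N α 0ℚ
proposition3p6 q r 1≤q _ α (ε , ε→0 , hyp) N 1≤N c
  with p , good , longest ← longestGoodPath r c (Fin.fromℕ< 1≤N)
  = p , good , λ s s<α → subst (λ e → N ^[ e ]≤ length p) (sym (ℚ.+-identityʳ s))
                           (goodPaths≤⇒^[]≤ α ε ε→0 hyp (Fin.fromℕ< 1≤q) c 1≤N longest s<α)
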